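{- Let $G=(V,E)$ be a bispanning graph and $(S,T)$ a pair of disjoint spanning trees with $S\cup T=E$. If $v\in V$ is a leaf of the tree $S$, incident in $S$ only to the edge $e\in S$, then there exists $f\in T$ with $D_G(S,e)\cap C_G(T,e)=\{e,f\}$ (so $(e,f)$ is a unique $S$ edge exchange). Analogously, if $v$ is a leaf of $T$ incident in $T$ only to $e\in T$, then there exists $f\in S$ with $D_G(T,e)\cap C_G(S,e)=\{e,f\}$.
   Context: Graphs are finite, undirected, possibly with parallel edges, no loops. A graph is bispanning if its edge set is the disjoint union of two spanning trees. For a spanning tree $T$ and $e\notin T$, $C_G(T,e)$ is the unique cycle (edge set) in $T+e$; for a spanning tree $S$ and $e\in S$, $D_G(S,e)$ is the set of edges of $G$ joining the two components of $S-e$ (including $e$). -}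

module Defs where

open import Data.Nat using (ℕ; suc)
open import Data.Fin using (Fin; _≟_)
open import Data.Fin.Subset using (Subset; _∈_; _∉_; _⊆_; _∩_; _∪_; _-_; ⁅_⁆; ∣_∣; ⊤; Nonempty; Empty)
open import Data.Vec using (tabulate)
open import Data.Bool using (_∨_)
open import Data.Product using (Σ; _×_; _,_)
open import Data.Sum using (_⊎_)
open import Relation.Nullary using (¬_)
open import Relation.Nullary.Decidable using (isYes)
open import Relation.Binary.PropositionalEquality using (_≡_; _≢_)
open import Relation.Binary.Construct.Closure.ReflexiveTransitive using (Star)

-- A finite undirected multigraph without loops: vertices Fin n, edges Fin m,
-- each edge e has two distinct endpoints src e and tgt e (orientation irrelevant).
record Graph : Set where
  field
    n   : ℕ
    m   : ℕ
    src : Fin m → Fin n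
    tgt : Fin m → Fin n
    noLoop : ∀ e → src e ≢ tgt e

module _ (G : Graph) where
  open Graph G

  EdgeSet : Set
  EdgeSet = Subset m

  Incident : Fin m → Fin n → Set
  Incident e v = (src e ≡ v) ⊎ (tgt e ≡ v)

  incAt : Fin n → EdgeSet
  incAt v = tabulate (λ e → isYes (src e ≟ v) ∨ isYes (tgt e ≟ v))

  deg : EdgeSet → Fin n → ℕ
  deg C v = ∣ C ∩ incAt v ∣

  Adj : EdgeSet → Fin n → Fin n → Set
  Adj C x y = Σ (Fin m) λ e → e ∈ C × ((src e ≡ x × tgt e ≡ y) ⊎ (src e ≡ y × tgt e ≡ x))

  Reach : EdgeSet → Fin n → Fin n → Set
  Reach C = Star (Adj C)

  IsCycle : EdgeSet → Set
  IsCycle C = Nonempty C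
            × (∀ v → (deg C v ≡ 0) ⊎ (deg C v ≡ 2))
            × (∀ u w → deg C u ≢ 0 → deg C w ≢ 0 → Reach C u w)

  IsSpanningTree : EdgeSet → Set
  IsSpanningTree T = (∀ u w → Reach T u w) × (∀ C → C ⊆ T → ¬ IsCycle C)

  IsBispanningPair : EdgeSet → EdgeSet → Set
  IsBispanningPair S T = IsSpanningTree S × IsSpanningTree T × Empty (S ∩ T) × (S ∪ T ≡ ⊤)

  -- C_G(T,e) for a spanning tree T and e ∉ T: C is a cycle contained in T + e.
  -- (It is unique, so "the" cycle C_G(T,e) is any C satisfying this.)
  IsFundCycle : EdgeSet → Fin m → EdgeSet → Set
  IsFundCycle T e C = IsCycle C × C ⊆ (T ∪ ⁅ e ⁆)

  -- f ∈ D_G(S,e): f joins the two components of S - e, i.e. its endpoints are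
  -- not connected in S - e.
  InFundCut : EdgeSet → Fin m → Fin m → Set
  InFundCut S e f = ¬ Reach (S - e) (src f) (tgt f)

  IsLeafVia : EdgeSet → Fin n → Fin m → Set
  IsLeafVia S v e = e ∈ S × Incident e v × deg S v ≡ 1

  CutCycleIsPair : EdgeSet → Fin m → EdgeSet → Fin m → Set
  CutCycleIsPair S e C f =
    ∀ g → ((InFundCut S e g × g ∈ C) → (g ≡ e ⊎ g ≡ f))
        × ((g ≡ e ⊎ g ≡ f) → (InFundCut S e g × g ∈ C))

module Submission where

-- Let u be the other end of e and f the edge by which a walk in T from u first reaches v.
-- As T is acyclic, f is a bridge, so u and v lie in different components of T - f.
-- The fundamental cycle C of e crosses that cut at e, and an edge set of even degrees
-- crosses every cut an even number of times, so f ∈ C. Since v is a leaf of S, the cut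
-- D(S,e) consists of the edges at v, and C has degree 2 at v, so it meets D(S,e) in e and f only.
-- The second claim is the first with S and T exchanged.

open import Defs
open import Data.Bool using (Bool; true; false; _∧_; _∨_)
open import Data.Bool.Properties using (∨-zeroʳ)
open import Data.Empty using (⊥-elim)
open import Data.Fin using (Fin; zero; suc; _≟_)
open import Data.Fin.Properties using (suc-injective)
open import Data.Fin.Subset
  using (Subset; _∈_; _∉_; _⊆_; _∩_; _∪_; _─_; _-_; ⁅_⁆; ∣_∣; ⊥)
open import Data.Fin.Subset.Properties
  using (x∈⁅x⁆; x∈⁅y⁆⇒x≡y; x∈p∩q⁺; x∈p∪q⁺; x∈p∪q⁻; x∈p∧x≢y⇒x∈p-y; p─q⊆p; x∈p⇒∣p-x∣<∣p∣; _∈?_; ∉⊥)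
open import Data.Nat using (ℕ; zero; suc; _+_; _*_; _≤_; s≤s; z≤n)
open import Data.Nat.Divisibility using (_∣_; _∣0; ∣-refl; ∣m∣n⇒∣m+n; ∣m+n∣m⇒∣n; ∣n⇒∣m*n; ∣1⇒≡1)
open import Data.Nat.Properties
  using (+-*-semiring; +-identityʳ; +-comm; +-assoc; *-comm; *-assoc; *-distribʳ-+; ≤-trans)
open import Data.Product using (Σ; _×_; _,_; proj₁; proj₂)
open import Data.Sum using (_⊎_; inj₁; inj₂)
open import Data.Vec using ([]; _∷_; lookup; here; there)
open import Data.Vec.Properties using (lookup-zipWith; lookup∘tabulate; []=⇒lookup; lookup⇒[]=)
open import Function using (_∘_)
open import Relation.Binary.Construct.Closure.ReflexiveTransitive using (ε; _◅_; _◅◅_; gmap; reverse)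
open import Relation.Binary.PropositionalEquality
  using (_≡_; _≢_; refl; sym; trans; cong; cong₂; subst; ≢-sym; module ≡-Reasoning)
open import Relation.Nullary using (¬_; Dec; yes; no; does; contradiction)
open import Relation.Nullary.Decidable using (isYes; isYes≗does; dec-true; dec-false; ¬¬-excluded-middle)

open import Algebra.Properties.Semiring.Sum +-*-semiring
  using (sum; sum-syntax; sum-cong-≗; sum-replicate-zero; ∑-comm; ∑-distrib-+; *-distribˡ-sum)

𝟙 : Bool → ℕ
𝟙 true  = 1
𝟙 false = 0

χ : ∀ {k} → Subset k → Fin k → ℕ
χ p i = 𝟙 (lookup p i)

-- Defined with does rather than isYes so that δ (suc i) (suc j) reduces to δ i j.
δ : ∀ {k} → Fin k → Fin k → ℕ
δ i j = 𝟙 (does (i ≟ j))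

δ-refl : ∀ {k} (i : Fin k) → δ i i ≡ 1
δ-refl i = cong 𝟙 (dec-true (i ≟ i) refl)

δ-≢ : ∀ {k} {i j : Fin k} → i ≢ j → δ i j ≡ 0
δ-≢ {i = i} {j} i≢j = cong 𝟙 (dec-false (i ≟ j) i≢j)

χ-∈ : ∀ {k} {p : Subset k} {i} → i ∈ p → χ p i ≡ 1
χ-∈ i∈p = cong 𝟙 ([]=⇒lookup i∈p)

χ-∉ : ∀ {k} {p : Subset k} {i} → i ∉ p → χ p i ≡ 0
χ-∉ {p = p} {i} i∉p with lookup p i in eq
... | true  = contradiction (lookup⇒[]= i p eq) i∉p
... | false = refl

χ-∩ : ∀ {k} (p q : Subset k) i → χ (p ∩ q) i ≡ χ p i * χ q i
χ-∩ p q i rewrite lookup-zipWith _∧_ i p q with lookup p i | lookup q i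
... | true  | true  = refl
... | true  | false = refl
... | false | _     = refl

χ-insert : ∀ {k} {a : Fin k} {p} → a ∉ p → ∀ i → χ (⁅ a ⁆ ∪ p) i ≡ δ a i + χ p i
χ-insert {a = a} {p} a∉p i with i ≟ a
... | yes refl = trans (χ-∈ (x∈p∪q⁺ (inj₁ (x∈⁅x⁆ a)))) (sym (cong₂ _+_ (δ-refl a) (χ-∉ a∉p)))
... | no i≢a with i ∈? p
...   | yes i∈p = trans (χ-∈ (x∈p∪q⁺ {p = ⁅ a ⁆} (inj₂ i∈p))) (sym (cong₂ _+_ (δ-≢ (≢-sym i≢a)) (χ-∈ i∈p)))
...   | no i∉p  = trans (χ-∉ i∉a∪p) (sym (cong₂ _+_ (δ-≢ (≢-sym i≢a)) (χ-∉ i∉p)))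
  where
    i∉a∪p : i ∉ ⁅ a ⁆ ∪ p
    i∉a∪p i∈ with x∈p∪q⁻ ⁅ a ⁆ p i∈
    ... | inj₁ i∈a = i≢a (x∈⁅y⁆⇒x≡y a i∈a)
    ... | inj₂ i∈p = i∉p i∈p

∣p∣≡∑χ : ∀ {k} (p : Subset k) → ∣ p ∣ ≡ ∑[ i < k ] χ p i
∣p∣≡∑χ []          = refl
∣p∣≡∑χ (true  ∷ p) = cong suc (∣p∣≡∑χ p)
∣p∣≡∑χ (false ∷ p) = ∣p∣≡∑χ p

∑-δ : ∀ {k} (j : Fin k) (f : Fin k → ℕ) → ∑[ i < k ] (δ j i * f i) ≡ f j
∑-δ {suc k} zero    f = trans (cong₂ _+_ (+-identityʳ (f zero)) (sum-replicate-zero k)) (+-identityʳ (f zero))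
∑-δ {suc k} (suc j) f = ∑-δ j (f ∘ suc)

∑-even : ∀ {k} (t : Fin k → ℕ) → (∀ i → 2 ∣ t i) → 2 ∣ sum t
∑-even {zero}  t even = 2 ∣0
∑-even {suc k} t even = ∣m∣n⇒∣m+n (even zero) (∑-even (t ∘ suc) (even ∘ suc))

∑-even⇒term-even : ∀ {k} (t : Fin k → ℕ) i → 2 ∣ sum t → (∀ j → j ≢ i → 2 ∣ t j) → 2 ∣ t i
∑-even⇒term-even t zero    ∣∑ others =
  ∣m+n∣m⇒∣n (subst (2 ∣_) (+-comm (t zero) _) ∣∑) rest
  where
  rest : 2 ∣ sum (t ∘ suc)
  rest = ∑-even (t ∘ suc) (λ j → others (suc j) (λ ()))
∑-even⇒term-even t (suc i) ∣∑ others =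
  ∑-even⇒term-even (t ∘ suc) i (∣m+n∣m⇒∣n ∣∑ (others zero (λ ()))) (λ j j≢i → others (suc j) (j≢i ∘ suc-injective))

1≤∣p∣ : ∀ {k} {p : Subset k} {a} → a ∈ p → 1 ≤ ∣ p ∣
1≤∣p∣ a∈p = ≤-trans (s≤s z≤n) (x∈p⇒∣p-x∣<∣p∣ a∈p)

2≤∣p∣ : ∀ {k} {p : Subset k} {a b} → a ∈ p → b ∈ p → a ≢ b → 2 ≤ ∣ p ∣
2≤∣p∣ a∈p b∈p a≢b = ≤-trans (s≤s (1≤∣p∣ (x∈p∧x≢y⇒x∈p-y b∈p (≢-sym a≢b)))) (x∈p⇒∣p-x∣<∣p∣ a∈p)

3≤∣p∣ : ∀ {k} {p : Subset k} {a b c} → a ∈ p → b ∈ p → c ∈ p → a ≢ b → a ≢ c → b ≢ c → 3 ≤ ∣ p ∣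
3≤∣p∣ a∈p b∈p c∈p a≢b a≢c b≢c =
  ≤-trans (s≤s (2≤∣p∣ (x∈p∧x≢y⇒x∈p-y b∈p (≢-sym a≢b)) (x∈p∧x≢y⇒x∈p-y c∈p (≢-sym a≢c)) b≢c))
          (x∈p⇒∣p-x∣<∣p∣ a∈p)

x∈p─q⇒x∉q : ∀ {k} {p q : Subset k} {x} → x ∈ p ─ q → x ∉ q
x∈p─q⇒x∉q {p = _ ∷ p} {true  ∷ q} ()        here
x∈p─q⇒x∉q {p = _ ∷ p} {false ∷ q} here      ()
x∈p─q⇒x∉q {p = _ ∷ p} {_     ∷ q} (there h) (there h′) = x∈p─q⇒x∉q h h′

x∈p-y⇒x≢y : ∀ {k} {p : Subset k} {x y} → x ∈ p - y → x ≢ y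
x∈p-y⇒x≢y {y = y} x∈ refl = x∈p─q⇒x∉q x∈ (x∈⁅x⁆ y)

¬¬-Decidable : ∀ {k} (P : Fin k → Set) → ¬ ¬ (∀ i → Dec (P i))
¬¬-Decidable {zero}  P ¬dec = ¬dec λ ()
¬¬-Decidable {suc k} P ¬dec = ¬¬-excluded-middle λ P₀? →
  ¬¬-Decidable (P ∘ suc) λ dec → ¬dec λ { zero → P₀? ; (suc i) → dec i }

module _ (G : Graph) where
  open Graph G

  Joins : Fin m → Fin n → Fin n → Set
  Joins a x y = (src a ≡ x × tgt a ≡ y) ⊎ (src a ≡ y × tgt a ≡ x)

  Joins-sym : ∀ {a x y} → Joins a x y → Joins a y x
  Joins-sym (inj₁ ends) = inj₂ ends
  Joins-sym (inj₂ ends) = inj₁ ends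

  Joins⇒≢ : ∀ {a x y} → Joins a x y → x ≢ y
  Joins⇒≢ (inj₁ (refl , refl)) = noLoop _
  Joins⇒≢ (inj₂ (refl , refl)) = noLoop _ ∘ sym

  Joins-unique : ∀ {a x y z} → Joins a x z → Joins a y z → x ≡ y
  Joins-unique (inj₁ (refl , refl)) (inj₁ (refl , _))    = refl
  Joins-unique (inj₁ (refl , refl)) (inj₂ (sa≡z , refl)) = contradiction sa≡z (noLoop _)
  Joins-unique (inj₂ (refl , refl)) (inj₁ (refl , ta≡z)) = contradiction (sym ta≡z) (noLoop _)
  Joins-unique (inj₂ (refl , refl)) (inj₂ (_ , refl))    = refl

  Joins⇒Incidentˡ : ∀ {a x y} → Joins a x y → Incident G a x
  Joins⇒Incidentˡ (inj₁ (sa≡x , _)) = inj₁ sa≡x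
  Joins⇒Incidentˡ (inj₂ (_ , ta≡x)) = inj₂ ta≡x

  Joins⇒Incidentʳ : ∀ {a x y} → Joins a x y → Incident G a y
  Joins⇒Incidentʳ = Joins⇒Incidentˡ ∘ Joins-sym

  Incident⇒end : ∀ {a z x y} → Incident G a z → Joins a x y → z ≡ x ⊎ z ≡ y
  Incident⇒end (inj₁ refl) (inj₁ (sa≡x , _)) = inj₁ sa≡x
  Incident⇒end (inj₁ refl) (inj₂ (sa≡y , _)) = inj₂ sa≡y
  Incident⇒end (inj₂ refl) (inj₁ (_ , ta≡y)) = inj₂ ta≡y
  Incident⇒end (inj₂ refl) (inj₂ (_ , ta≡x)) = inj₁ ta≡x

  Incident⇒Joins : ∀ {a v} → Incident G a v → Σ (Fin n) λ u → Joins a u v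
  Incident⇒Joins {a} (inj₁ sa≡v) = tgt a , inj₂ (sa≡v , refl)
  Incident⇒Joins {a} (inj₂ ta≡v) = src a , inj₁ (refl , ta≡v)

  Reach-sym : ∀ {A x y} → Reach G A x y → Reach G A y x
  Reach-sym = reverse λ { (a , a∈A , j) → a , a∈A , Joins-sym j }

  Reach-mono : ∀ {A B} → A ⊆ B → ∀ {x y} → Reach G A x y → Reach G B x y
  Reach-mono A⊆B = gmap (λ x → x) λ { (a , a∈A , j) → a , A⊆B a∈A , j }

  Acyclic : EdgeSet G → Set
  Acyclic A = ∀ C → C ⊆ A → ¬ IsCycle G C

  inc : Fin m → Fin n → ℕ
  inc a x = δ (src a) x + δ (tgt a) x

  inc-Joins : ∀ {a x y} → Joins a x y → ∀ z → inc a z ≡ δ x z + δ y z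
  inc-Joins (inj₁ (refl , refl)) z = refl
  inc-Joins {a} (inj₂ (refl , refl)) z = +-comm (δ (src a) z) (δ (tgt a) z)

  lookup-incAt : ∀ x a → lookup (incAt G x) a ≡ does (src a ≟ x) ∨ does (tgt a ≟ x)
  lookup-incAt x a = trans (lookup∘tabulate (λ a → isYes (src a ≟ x) ∨ isYes (tgt a ≟ x)) a)
                           (cong₂ _∨_ (isYes≗does (src a ≟ x)) (isYes≗does (tgt a ≟ x)))

  χ-incAt : ∀ x a → χ (incAt G x) a ≡ inc a x
  χ-incAt x a rewrite lookup-incAt x a with src a ≟ x | tgt a ≟ x
  ... | yes sa≡x | yes ta≡x = contradiction (trans sa≡x (sym ta≡x)) (noLoop a)
  ... | yes _    | no _     = refl
  ... | no _     | yes _    = refl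
  ... | no _     | no _     = refl

  Incident⇒∈incAt : ∀ {a x} → Incident G a x → a ∈ incAt G x
  Incident⇒∈incAt {a} {x} a∋x = lookup⇒[]= a (incAt G x) (trans (lookup-incAt x a) (one-end-is-x a∋x))
    where
    one-end-is-x : Incident G a x → does (src a ≟ x) ∨ does (tgt a ≟ x) ≡ true
    one-end-is-x (inj₁ sa≡x) = cong (_∨ does (tgt a ≟ x)) (dec-true (src a ≟ x) sa≡x)
    one-end-is-x (inj₂ ta≡x) = trans (cong (does (src a ≟ x) ∨_) (dec-true (tgt a ≟ x) ta≡x)) (∨-zeroʳ _)

  ∈∩incAt : ∀ {a C v} → a ∈ C → Incident G a v → a ∈ C ∩ incAt G v
  ∈∩incAt a∈C a∋v = x∈p∩q⁺ (a∈C , Incident⇒∈incAt a∋v)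

  deg≡∑ : ∀ C x → deg G C x ≡ ∑[ a < m ] (χ C a * inc a x)
  deg≡∑ C x = trans (∣p∣≡∑χ (C ∩ incAt G x))
                    (sum-cong-≗ λ a → trans (χ-∩ C (incAt G x) a) (cong (χ C a *_) (χ-incAt x a)))

  deg-⊥ : ∀ x → deg G ⊥ x ≡ 0
  deg-⊥ x = trans (deg≡∑ ⊥ x) (trans (sum-cong-≗ {y = λ _ → 0} λ a → cong (_* inc a x) (χ-∉ {p = ⊥} {a} ∉⊥)) (sum-replicate-zero m))

  deg-insert : ∀ {a P} → a ∉ P → ∀ x → deg G (⁅ a ⁆ ∪ P) x ≡ inc a x + deg G P x
  deg-insert {a} {P} a∉P x = begin
    deg G (⁅ a ⁆ ∪ P) x                                                 ≡⟨ deg≡∑ (⁅ a ⁆ ∪ P) x ⟩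
    ∑[ b < m ] (χ (⁅ a ⁆ ∪ P) b * inc b x)                              ≡⟨ sum-cong-≗ split ⟩
    ∑[ b < m ] (δ a b * inc b x + χ P b * inc b x)                      ≡⟨ ∑-distrib-+ (λ b → δ a b * inc b x) (λ b → χ P b * inc b x) ⟩
    ∑[ b < m ] (δ a b * inc b x) + ∑[ b < m ] (χ P b * inc b x)         ≡⟨ cong₂ _+_ (∑-δ a (λ b → inc b x)) (sym (deg≡∑ P x)) ⟩
    inc a x + deg G P x                                                 ∎
    where
    open ≡-Reasoning
    split : ∀ b → χ (⁅ a ⁆ ∪ P) b * inc b x ≡ δ a b * inc b x + χ P b * inc b x
    split b = trans (cong (_* inc b x) (χ-insert a∉P b)) (*-distribʳ-+ (inc b x) (δ a b) (χ P b))

  deg-insert-Joins : ∀ {a x y P} → a ∉ P → Joins a x y → ∀ z → deg G (⁅ a ⁆ ∪ P) z ≡ δ x z + δ y z + deg G P z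
  deg-insert-Joins {P = P} a∉P j z = trans (deg-insert a∉P z) (cong (_+ deg G P z) (inc-Joins j z))

  ∑-inc : ∀ a (w : Fin n → ℕ) → ∑[ x < n ] (inc a x * w x) ≡ w (src a) + w (tgt a)
  ∑-inc a w = begin
    ∑[ x < n ] (inc a x * w x)                                          ≡⟨ sum-cong-≗ (λ x → *-distribʳ-+ (w x) (δ (src a) x) (δ (tgt a) x)) ⟩
    ∑[ x < n ] (δ (src a) x * w x + δ (tgt a) x * w x)                  ≡⟨ ∑-distrib-+ (λ x → δ (src a) x * w x) (λ x → δ (tgt a) x * w x) ⟩
    ∑[ x < n ] (δ (src a) x * w x) + ∑[ x < n ] (δ (tgt a) x * w x)     ≡⟨ cong₂ _+_ (∑-δ (src a) w) (∑-δ (tgt a) w) ⟩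
    w (src a) + w (tgt a)                                               ∎
    where open ≡-Reasoning

  handshake : ∀ C (w : Fin n → ℕ) → ∑[ x < n ] (w x * deg G C x) ≡ ∑[ a < m ] (χ C a * (w (src a) + w (tgt a)))
  handshake C w = begin
    ∑[ x < n ] (w x * deg G C x)                                        ≡⟨ sum-cong-≗ (λ x → cong (w x *_) (deg≡∑ C x)) ⟩
    ∑[ x < n ] (w x * ∑[ a < m ] (χ C a * inc a x))                    ≡⟨ sum-cong-≗ (λ x → *-distribˡ-sum (w x) (λ a → χ C a * inc a x)) ⟩
    ∑[ x < n ] ∑[ a < m ] (w x * (χ C a * inc a x))                    ≡⟨ ∑-comm (λ x a → w x * (χ C a * inc a x)) ⟩
    ∑[ a < m ] ∑[ x < n ] (w x * (χ C a * inc a x))                    ≡⟨ sum-cong-≗ (λ a → sum-cong-≗ λ x → reorder (w x) (χ C a) (inc a x)) ⟩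
    ∑[ a < m ] ∑[ x < n ] (χ C a * (inc a x * w x))                    ≡⟨ sum-cong-≗ (λ a → sym (*-distribˡ-sum (χ C a) (λ x → inc a x * w x))) ⟩
    ∑[ a < m ] (χ C a * ∑[ x < n ] (inc a x * w x))                    ≡⟨ sum-cong-≗ (λ a → cong (χ C a *_) (∑-inc a w)) ⟩
    ∑[ a < m ] (χ C a * (w (src a) + w (tgt a)))                       ∎
    where
    open ≡-Reasoning
    reorder : ∀ p q r → p * (q * r) ≡ q * (r * p)
    reorder p q r = trans (*-comm p (q * r)) (*-assoc q r p)

  -- Summing the degrees over the vertices of Y counts an edge of C once if it crosses Y and
  -- twice if it lies inside Y, so an even-degree edge set cannot cross Y exactly once.
  evenDegree⇒¬uniqueCrossing : ∀ {C e} → (∀ x → 2 ∣ deg G C x) → (Y : Fin n → Bool)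
    → e ∈ C → Y (src e) ≢ Y (tgt e) → ¬ (∀ a → a ∈ C → a ≢ e → Y (src a) ≡ Y (tgt a))
  evenDegree⇒¬uniqueCrossing {C} {e} even Y e∈C e-crosses others =
    2∤1 (subst (2 ∣_) e-term (∑-even⇒term-even crossings e ∑-crossings-even others-even))
    where
    w : Fin n → ℕ
    w x = 𝟙 (Y x)

    crossings : Fin m → ℕ
    crossings a = χ C a * (w (src a) + w (tgt a))

    ∑-crossings-even : 2 ∣ sum crossings
    ∑-crossings-even = subst (2 ∣_) (handshake C w) (∑-even (λ x → w x * deg G C x) (λ x → ∣n⇒∣m*n (w x) (even x)))

    others-even : ∀ a → a ≢ e → 2 ∣ crossings a
    others-even a a≢e with a ∈? C
    ... | no a∉C  rewrite χ-∉ a∉C = 2 ∣0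
    ... | yes a∈C rewrite χ-∈ a∈C | others a a∈C a≢e with Y (tgt a)
    ...   | true  = ∣-refl
    ...   | false = 2 ∣0

    e-term : crossings e ≡ 1
    e-term rewrite χ-∈ e∈C with Y (src e) | Y (tgt e)
    ... | true  | true  = contradiction refl e-crosses
    ... | true  | false = refl
    ... | false | true  = refl
    ... | false | false = contradiction refl e-crosses

    2∤1 : ¬ 2 ∣ 1
    2∤1 2∣1 with ∣1⇒≡1 2∣1
    ... | ()

  cycle⇒evenDegree : ∀ {C} → IsCycle G C → ∀ x → 2 ∣ deg G C x
  cycle⇒evenDegree (_ , degrees , _) x with degrees x
  ... | inj₁ d≡0 rewrite d≡0 = 2 ∣0
  ... | inj₂ d≡2 rewrite d≡2 = ∣-refl

  mutual
    data Path (A : EdgeSet G) : Fin n → Fin n → Set where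
      []   : ∀ {x} → Path A x x
      cons : ∀ {x y z} → Adj G A x y → (p : Path A y z) → x ∉ᵥ p → Path A x z

    _∈ᵥ_ : ∀ {A x z} → Fin n → Path A x z → Set
    w ∈ᵥ ([] {x})         = w ≡ x
    w ∈ᵥ (cons {x} _ p _) = w ≡ x ⊎ w ∈ᵥ p

    _∉ᵥ_ : ∀ {A x z} → Fin n → Path A x z → Set
    w ∉ᵥ p = ¬ w ∈ᵥ p

  _∈ᵥ?_ : ∀ {A x z} w (p : Path A x z) → Dec (w ∈ᵥ p)
  w ∈ᵥ? ([] {x})         = w ≟ x
  w ∈ᵥ? (cons {x} _ p _) with w ≟ x | w ∈ᵥ? p
  ... | yes w≡x | _       = yes (inj₁ w≡x)
  ... | no _    | yes w∈p = yes (inj₂ w∈p)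
  ... | no w≢x  | no w∉p  = no λ { (inj₁ w≡x) → w≢x w≡x ; (inj₂ w∈p) → w∉p w∈p }

  start∈ᵥ : ∀ {A x z} (p : Path A x z) → x ∈ᵥ p
  start∈ᵥ []           = refl
  start∈ᵥ (cons _ _ _) = inj₁ refl

  end∈ᵥ : ∀ {A x z} (p : Path A x z) → z ∈ᵥ p
  end∈ᵥ []           = refl
  end∈ᵥ (cons _ p _) = inj₂ (end∈ᵥ p)

  suffix : ∀ {A x z w} (p : Path A x z) → w ∈ᵥ p → Path A w z
  suffix []             refl       = []
  suffix (cons s p x∉p) (inj₁ refl) = cons s p x∉p
  suffix (cons s p x∉p) (inj₂ w∈p)  = suffix p w∈p

  -- Loop erasure: a walk that revisits its start is cut back to the last visit.
  walk⇒path : ∀ {A x y} → Reach G A x y → Path A x y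
  walk⇒path ε = []
  walk⇒path {x = x} (s ◅ walk) with walk⇒path walk
  ... | p with x ∈ᵥ? p
  ...   | yes x∈p = suffix p x∈p
  ...   | no x∉p  = cons s p x∉p

  edges : ∀ {A x z} → Path A x z → EdgeSet G
  edges []                 = ⊥
  edges (cons (a , _) p _) = ⁅ a ⁆ ∪ edges p

  edges⊆ : ∀ {A x z} (p : Path A x z) → edges p ⊆ A
  edges⊆ []                        b∈ = contradiction b∈ ∉⊥
  edges⊆ (cons (a , a∈A , _) p _) b∈ with x∈p∪q⁻ ⁅ a ⁆ (edges p) b∈
  ... | inj₁ b∈a  rewrite x∈⁅y⁆⇒x≡y a b∈a = a∈A
  ... | inj₂ b∈p = edges⊆ p b∈p

  edge⇒ends∈ᵥ : ∀ {A x z} (p : Path A x z) {b w} → b ∈ edges p → Incident G b w → w ∈ᵥ p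
  edge⇒ends∈ᵥ []                      b∈ _     = contradiction b∈ ∉⊥
  edge⇒ends∈ᵥ (cons (a , _ , j) p _) b∈ inc-b with x∈p∪q⁻ ⁅ a ⁆ (edges p) b∈
  ... | inj₂ b∈p = inj₂ (edge⇒ends∈ᵥ p b∈p inc-b)
  ... | inj₁ b∈a rewrite x∈⁅y⁆⇒x≡y a b∈a with Incident⇒end inc-b j
  ...   | inj₁ w≡x    = inj₁ w≡x
  ...   | inj₂ refl   = inj₂ (start∈ᵥ p)

  first∉edges : ∀ {A x y z a} (j : Joins a x y) (p : Path A y z) → x ∉ᵥ p → a ∉ edges p
  first∉edges j p x∉p a∈p = x∉p (edge⇒ends∈ᵥ p a∈p (Joins⇒Incidentˡ j))

  ∈ᵥ⇒Reach : ∀ {A x z} (p : Path A x z) {w} → w ∈ᵥ p → Reach G (edges p) x w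
  ∈ᵥ⇒Reach []                       refl        = ε
  ∈ᵥ⇒Reach (cons _ _ _)             (inj₁ refl) = ε
  ∈ᵥ⇒Reach (cons (a , _ , j) p _) (inj₂ w∈p)  =
    (a , x∈p∪q⁺ (inj₁ (x∈⁅x⁆ a)) , j) ◅ Reach-mono (λ b∈ → x∈p∪q⁺ (inj₂ b∈)) (∈ᵥ⇒Reach p w∈p)

  deg-cons : ∀ {A x y z} (s : Adj G A x y) (p : Path A y z) (x∉p : x ∉ᵥ p) w
    → deg G (edges (cons s p x∉p)) w ≡ δ x w + δ y w + deg G (edges p) w
  deg-cons (_ , _ , j) p x∉p = deg-insert-Joins (first∉edges j p x∉p) j

  mutual
    deg-on : ∀ {A x z} (p : Path A x z) {w} → w ∈ᵥ p → δ x w + δ z w + deg G (edges p) w ≡ 2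
    deg-on [] {w} refl rewrite δ-refl w | deg-⊥ w = refl
    deg-on (cons {x} {y} {z} s p x∉p) (inj₁ refl)
      rewrite deg-cons s p x∉p x | deg-off p x∉p | δ-refl x
            | δ-≢ (Joins⇒≢ (Joins-sym (proj₂ (proj₂ s))))
            | δ-≢ {i = z} (λ z≡x → x∉p (subst (_∈ᵥ p) z≡x (end∈ᵥ p))) = refl
    deg-on (cons {x} {y} {z} s p x∉p) {w} (inj₂ w∈p)
      rewrite deg-cons s p x∉p w | δ-≢ {i = x} (λ x≡w → x∉p (subst (_∈ᵥ p) (sym x≡w) w∈p)) =
      trans (sym (+-assoc (δ z w) (δ y w) _))
            (trans (cong (_+ deg G (edges p) w) (+-comm (δ z w) (δ y w))) (deg-on p w∈p))

    deg-off : ∀ {A x z} (p : Path A x z) {w} → w ∉ᵥ p → deg G (edges p) w ≡ 0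
    deg-off [] {w} _ = deg-⊥ w
    deg-off (cons {x} {y} s p x∉p) {w} w∉
      rewrite deg-cons s p x∉p w | deg-off p (w∉ ∘ inj₂)
            | δ-≢ {i = x} (λ x≡w → w∉ (inj₁ (sym x≡w)))
            | δ-≢ {i = y} (λ y≡w → w∉ (inj₂ (subst (_∈ᵥ p) y≡w (start∈ᵥ p)))) = refl

  closedPath⇒cycle : ∀ {A x y f} (p : Path A x y) → Joins f x y → f ∉ edges p → IsCycle G (⁅ f ⁆ ∪ edges p)
  closedPath⇒cycle {x = x} {y} {f} p j f∉p = (f , x∈p∪q⁺ (inj₁ (x∈⁅x⁆ f))) , degree , connected
    where
    C : EdgeSet G
    C = ⁅ f ⁆ ∪ edges p

    deg-C-off : ∀ {z} → z ∉ᵥ p → deg G C z ≡ 0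
    deg-C-off {z} z∉p rewrite deg-insert-Joins f∉p j z | deg-off p z∉p
      | δ-≢ {i = x} (λ x≡z → z∉p (subst (_∈ᵥ p) x≡z (start∈ᵥ p)))
      | δ-≢ {i = y} (λ y≡z → z∉p (subst (_∈ᵥ p) y≡z (end∈ᵥ p))) = refl

    degree : ∀ z → deg G C z ≡ 0 ⊎ deg G C z ≡ 2
    degree z with z ∈ᵥ? p
    ... | yes z∈p = inj₂ (trans (deg-insert-Joins f∉p j z) (deg-on p z∈p))
    ... | no z∉p  = inj₁ (deg-C-off z∉p)

    reach-from-x : ∀ z → deg G C z ≢ 0 → Reach G C x z
    reach-from-x z deg≢0 with z ∈ᵥ? p
    ... | yes z∈p = Reach-mono (λ b∈ → x∈p∪q⁺ (inj₂ b∈)) (∈ᵥ⇒Reach p z∈p)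
    ... | no z∉p  = contradiction (deg-C-off z∉p) deg≢0

    connected : ∀ u w → deg G C u ≢ 0 → deg G C w ≢ 0 → Reach G C u w
    connected u w u≢0 w≢0 = Reach-sym (reach-from-x u u≢0) ◅◅ reach-from-x w w≢0

  acyclic⇒bridge : ∀ {A f x y} → Acyclic A → f ∈ A → Joins f x y → ¬ Reach G (A - f) x y
  acyclic⇒bridge {A} {f} {x} {y} acyclic f∈A j walk =
    acyclic (⁅ f ⁆ ∪ edges p) C⊆A (closedPath⇒cycle p j λ f∈p → x∈p-y⇒x≢y (edges⊆ p f∈p) refl)
    where
    p : Path (A - f) x y
    p = walk⇒path walk

    C⊆A : ⁅ f ⁆ ∪ edges p ⊆ A
    C⊆A b∈ with x∈p∪q⁻ ⁅ f ⁆ (edges p) b∈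
    ... | inj₁ b∈f rewrite x∈⁅y⁆⇒x≡y f b∈f = f∈A
    ... | inj₂ b∈p = p─q⊆p A ⁅ f ⁆ (edges⊆ p b∈p)

  fundCycle⊆ : ∀ {T e C a} → IsFundCycle G T e C → a ∈ C → a ≢ e → a ∈ T
  fundCycle⊆ {T} {e} (_ , C⊆T+e) a∈C a≢e with x∈p∪q⁻ T ⁅ e ⁆ (C⊆T+e a∈C)
  ... | inj₁ a∈T = a∈T
  ... | inj₂ a∈e = contradiction (x∈⁅y⁆⇒x≡y e a∈e) a≢e

  fundCycle∋e : ∀ {T e C} → Acyclic T → IsFundCycle G T e C → e ∈ C
  fundCycle∋e {e = e} {C} acyclic fc@(cycle , _) with e ∈? C
  ... | yes e∈C = e∈C
  ... | no e∉C  = contradiction cycle (acyclic C λ a∈C → fundCycle⊆ fc a∈C λ { refl → e∉C a∈C })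

  Reach-closed : ∀ {A u} (reach? : ∀ x → Dec (Reach G A u x)) {a} → a ∈ A
    → does (reach? (src a)) ≡ does (reach? (tgt a))
  Reach-closed reach? {a} a∈A with reach? (src a) | reach? (tgt a)
  ... | yes _  | yes _  = refl
  ... | no _   | no _   = refl
  ... | yes us | no ¬ut = contradiction (us ◅◅ ((a , a∈A , inj₁ (refl , refl)) ◅ ε)) ¬ut
  ... | no ¬us | yes ut = contradiction (ut ◅◅ ((a , a∈A , inj₂ (refl , refl)) ◅ ε)) ¬us

  -- Reachability in T - f is decidable only under a double negation, which is enough
  -- because the goal f ∈ C is decidable.
  fundCycle∋separator : ∀ {T e C f u v} → IsFundCycle G T e C → e ∈ C → Joins e u v
    → ¬ Reach G (T - f) u v → f ∈ C
  fundCycle∋separator {T} {e} {C} {f} {u} {v} fc@(cycle , _) e∈C j ¬u⇝v with f ∈? C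
  ... | yes f∈C = f∈C
  ... | no f∉C  = ⊥-elim (¬¬-Decidable (Reach G (T - f) u) no-separation)
    where
    no-separation : ¬ (∀ x → Dec (Reach G (T - f) u x))
    no-separation reach? = evenDegree⇒¬uniqueCrossing (cycle⇒evenDegree cycle) Y e∈C e-crosses λ a a∈C a≢e →
      Reach-closed reach? (x∈p∧x≢y⇒x∈p-y (fundCycle⊆ fc a∈C a≢e) λ { refl → f∉C a∈C })
      where
      Y : Fin n → Bool
      Y x = does (reach? x)

      Yu≢Yv : Y u ≢ Y v
      Yu≢Yv eq = contradiction (trans (sym (dec-true (reach? u) ε)) (trans eq (dec-false (reach? v) ¬u⇝v))) λ ()

      e-crosses : Y (src e) ≢ Y (tgt e)
      e-crosses = ends-separated j Yu≢Yv
        where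
        ends-separated : ∀ {a x y} → Joins a x y → Y x ≢ Y y → Y (src a) ≢ Y (tgt a)
        ends-separated (inj₁ (refl , refl)) = λ Yx≢Yy → Yx≢Yy
        ends-separated (inj₂ (refl , refl)) = λ Yx≢Yy → Yx≢Yy ∘ sym

  -- The walk is cut at its first visit to v.
  first-arrival : ∀ {T v x} → x ≢ v → Reach G T x v
    → Σ (Fin m) λ f → f ∈ T × Σ (Fin n) λ w → Joins f w v × Reach G (T - f) x w
  first-arrival x≢v ε = contradiction refl x≢v
  first-arrival {v = v} {x} x≢v (_◅_ {j = y} (a , a∈T , j) walk) with y ≟ v
  ... | yes refl = a , a∈T , x , j , ε
  ... | no y≢v with first-arrival y≢v walk
  ...   | f , f∈T , w , f-w-v , y⇝w = f , f∈T , w , f-w-v , (a , x∈p∧x≢y⇒x∈p-y a∈T a≢f , j) ◅ y⇝w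
    where
    a≢f : a ≢ f
    a≢f refl with Incident⇒end (Joins⇒Incidentʳ f-w-v) j
    ... | inj₁ v≡x = x≢v (sym v≡x)
    ... | inj₂ v≡y = y≢v (sym v≡y)

  module Leaf {S v e} (leaf : IsLeafVia G S v e) where
    private
      e∈S : e ∈ S
      e∈S = proj₁ leaf

      e∋v : Incident G e v
      e∋v = proj₁ (proj₂ leaf)

      degS≡1 : deg G S v ≡ 1
      degS≡1 = proj₂ (proj₂ leaf)

    leaf-edge-unique : ∀ {a} → a ∈ S → Incident G a v → a ≡ e
    leaf-edge-unique {a} a∈S a∋v with a ≟ e
    ... | yes a≡e = a≡e
    ... | no a≢e with subst (2 ≤_) degS≡1 (2≤∣p∣ (∈∩incAt a∈S a∋v) (∈∩incAt e∈S e∋v) a≢e)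
    ...   | s≤s ()

    leaf-isolated : ∀ {x} → Reach G (S - e) v x → x ≡ v
    leaf-isolated ε                     = refl
    leaf-isolated ((a , a∈S-e , j) ◅ _) =
      contradiction (leaf-edge-unique (p─q⊆p S ⁅ e ⁆ a∈S-e) (Joins⇒Incidentˡ j)) (x∈p-y⇒x≢y a∈S-e)

    Incident⇒InFundCut : ∀ {a} → Incident G a v → InFundCut G S e a
    Incident⇒InFundCut {a} (inj₁ refl) walk = noLoop a (sym (leaf-isolated walk))
    Incident⇒InFundCut {a} (inj₂ refl) walk = noLoop a (leaf-isolated (Reach-sym walk))

    -- A walk in S through v enters and leaves it along e, so it can skip v.
    avoid-leaf : ∀ {x y} → x ≢ v → y ≢ v → Reach G S x y → Reach G (S - e) x y
    avoid-leaf x≢v y≢v ε = ε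
    avoid-leaf x≢v y≢v (_◅_ {j = x₁} (a , a∈S , j) walk) with x₁ ≟ v
    ... | no x₁≢v = (a , x∈p∧x≢y⇒x∈p-y a∈S a≢e , j) ◅ avoid-leaf x₁≢v y≢v walk
      where
      a≢e : a ≢ e
      a≢e refl with Incident⇒end e∋v j
      ... | inj₁ v≡x  = x≢v (sym v≡x)
      ... | inj₂ v≡x₁ = x₁≢v (sym v≡x₁)
    avoid-leaf x≢v y≢v (_ ◅ ε) | yes x₁≡v = contradiction x₁≡v y≢v
    avoid-leaf {x} {y} x≢v y≢v ((a , a∈S , j) ◅ (_◅_ {j = x₂} (b , b∈S , j′) walk)) | yes refl =
      subst (λ z → Reach G (S - e) z y) (sym x≡x₂) (avoid-leaf (x≢v ∘ trans x≡x₂) y≢v walk)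
      where
      a≡e : a ≡ e
      a≡e = leaf-edge-unique a∈S (Joins⇒Incidentʳ j)
      b≡e : b ≡ e
      b≡e = leaf-edge-unique b∈S (Joins⇒Incidentˡ j′)
      x≡x₂ : x ≡ x₂
      x≡x₂ = Joins-unique (subst (λ c → Joins c x v) a≡e j) (subst (λ c → Joins c x₂ v) b≡e (Joins-sym j′))

    InFundCut⇒Incident : (∀ x y → Reach G S x y) → ∀ {a} → InFundCut G S e a → Incident G a v
    InFundCut⇒Incident S-connected {a} cut with src a ≟ v | tgt a ≟ v
    ... | yes sa≡v | _        = inj₁ sa≡v
    ... | no _     | yes ta≡v = inj₂ ta≡v
    ... | no sa≢v  | no ta≢v  = contradiction (avoid-leaf sa≢v ta≢v (S-connected (src a) (tgt a))) cut

  leaf-cut∩cycle : ∀ {S T v e u f} → IsLeafVia G S v e → (∀ x y → Reach G S x y) → Acyclic T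
    → Joins e u v → f ∈ T → e ∉ T → Incident G f v → ¬ Reach G (T - f) u v
    → ∀ C → IsFundCycle G T e C → CutCycleIsPair G S e C f
  leaf-cut∩cycle {S} {v = v} {e} {f = f} leaf S-connected T-acyclic j f∈T e∉T f∋v ¬u⇝v C fc g =
    to , from
    where
    open Leaf leaf

    e∋v : Incident G e v
    e∋v = Joins⇒Incidentʳ j

    e∈C : e ∈ C
    e∈C = fundCycle∋e T-acyclic fc

    f∈C : f ∈ C
    f∈C = fundCycle∋separator fc e∈C j ¬u⇝v

    e≢f : e ≢ f
    e≢f refl = e∉T f∈T

    degC≡2 : deg G C v ≡ 2
    degC≡2 with proj₁ (proj₂ (proj₁ fc)) v
    ... | inj₂ deg≡2 = deg≡2
    ... | inj₁ deg≡0 with subst (1 ≤_) deg≡0 (1≤∣p∣ (∈∩incAt e∈C e∋v))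
    ...   | ()

    to : InFundCut G S e g × g ∈ C → g ≡ e ⊎ g ≡ f
    to (cut , g∈C) with g ≟ e | g ≟ f
    ... | yes g≡e | _       = inj₁ g≡e
    ... | no _    | yes g≡f = inj₂ g≡f
    ... | no g≢e  | no g≢f
      with subst (3 ≤_) degC≡2 (3≤∣p∣ (∈∩incAt e∈C e∋v) (∈∩incAt f∈C f∋v)
                                       (∈∩incAt g∈C (InFundCut⇒Incident S-connected cut))
                                       e≢f (≢-sym g≢e) (≢-sym g≢f))
    ...   | s≤s (s≤s ())

    from : g ≡ e ⊎ g ≡ f → InFundCut G S e g × g ∈ C
    from (inj₁ refl) = Incident⇒InFundCut e∋v , e∈C
    from (inj₂ refl) = Incident⇒InFundCut f∋v , f∈C

  leaf-exchange : ∀ {S T v e} → IsSpanningTree G S → IsSpanningTree G T → e ∉ T → IsLeafVia G S v e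
    → Σ (Fin m) λ f → f ∈ T × (∀ C → IsFundCycle G T e C → CutCycleIsPair G S e C f)
  leaf-exchange {T = T} {v} (S-connected , _) (T-connected , T-acyclic) e∉T leaf
    with Incident⇒Joins (proj₁ (proj₂ leaf))
  ... | u , j with first-arrival (Joins⇒≢ j) (T-connected u v)
  ...   | f , f∈T , w , f-w-v , u⇝w =
    f , f∈T , leaf-cut∩cycle leaf S-connected T-acyclic j f∈T e∉T (Joins⇒Incidentʳ f-w-v) ¬u⇝v
    where
    ¬u⇝v : ¬ Reach G (T - f) u v
    ¬u⇝v u⇝v = acyclic⇒bridge T-acyclic f∈T f-w-v (Reach-sym u⇝w ◅◅ u⇝v)

mainTheorem5 : (G : Graph) → (S T : EdgeSet G) → IsBispanningPair G S T
    → (v : Fin (Graph.n G)) → (e : Fin (Graph.m G))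
    → (IsLeafVia G S v e
        → Σ (Fin (Graph.m G)) λ f → f ∈ T
          × (∀ C → IsFundCycle G T e C → CutCycleIsPair G S e C f))
    × (IsLeafVia G T v e
        → Σ (Fin (Graph.m G)) λ f → f ∈ S
          × (∀ C → IsFundCycle G S e C → CutCycleIsPair G T e C f))
mainTheorem5 G S T (S-tree , T-tree , disjoint , _) v e =
    (λ leaf → leaf-exchange G S-tree T-tree (λ e∈T → disjoint (e , x∈p∩q⁺ (proj₁ leaf , e∈T))) leaf)
  , (λ leaf → leaf-exchange G T-tree S-tree (λ e∈S → disjoint (e , x∈p∩q⁺ (e∈S , proj₁ leaf))) leaf)
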